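{- Let $\Gamma$ be a finite group and $\mathcal C$ a $\Gamma$-CSP instance. Then $\mathcal C$ is satisfiable if and only if the coloured graphs $G(\mathcal C)$ and $\tilde G(\mathcal C)$ are isomorphic.
   Context: A $\Gamma$-CSP instance is a finite set $\mathcal C$ of constraints of the form $(\bar x,\Delta\gamma)$, where $\bar x=(x_1,\dots,x_k)$ is a tuple of variables (from a finite set $\mathcal X$ of variables given implicitly), $\Delta\le\Gamma^k$ is a subgroup and $\gamma\in\Gamma^k$, so $\Delta\gamma$ is a coset (products taken componentwise). A solution is a map $\phi:\mathcal X\to\Gamma$ with $(\phi(x_1),\dots,\phi(x_k))\in\Delta\gamma$ for every constraint. The homogeneous constraint associated with $C=(\bar x,\Delta\gamma)$ is $\tilde C=(\bar x,\Delta)$. The coloured graph $G(\mathcal C)$: for every variable $x$, vertices $\gamma^{(x)}$ for all $\gamma\in\Gamma$, all with colour $L^{(x)}$; for every constraint $C=((x_1,\dots,x_k),\Delta\gamma)\in\mathcal C$, vertices $\beta^{(C)}$ for all $\beta\in\Delta\gamma$, all with colour $L^{(C)}$, and for each such $\beta=(\beta_1,\dots,\beta_k)$ and each $i\in[k]$ an edge $\{\beta^{(C)},\beta_i^{(x_i)}\}$ of colour $M^{(i)}$. The graph $\tilde G(\mathcal C)$ is defined in the same way from the homogeneous constraints: same variable vertices, and for each $C\in\mathcal C$ vertices $\beta^{(\tilde C)}$ for $\beta\in\Delta$ with colour $L^{(C)}$ (the colours $L^{(C)}$ and $L^{(\tilde C)}$ are identified) and edges $\{\beta^{(\tilde C)},\beta_i^{(x_i)}\}$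 of colour $M^{(i)}$. Isomorphisms must preserve vertex and edge colours. -}

module Defs where

open import Level using (0ℓ)
open import Data.Nat using (ℕ)
open import Data.Fin using (Fin; toℕ)
open import Data.Vec using (Vec; lookup; map; zipWith; replicate)
open import Data.Bool using (Bool; T)
open import Data.Product using (Σ; _×_; ∃; _,_)
open import Data.Empty using (⊥)
open import Data.Sum using (_⊎_; inj₁; inj₂)
open import Relation.Binary.PropositionalEquality using (_≡_)
open import Algebra.Structures using (IsGroup)
open import Function.Bundles using (_↔_; Inverse)

record FiniteGroup : Set₁ where
  field
    Carrier : Set
    _∙_     : Carrier → Carrier → Carrier
    ε       : Carrier
    _⁻¹     : Carrier → Carrier
    isGroup : IsGroup _≡_ _∙_ ε _⁻¹
    size    : ℕ
    finite  : Carrier ↔ Fin size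

module _ (Γ : FiniteGroup) where
  open FiniteGroup Γ

  _∙ᵏ_ : ∀ {k} → Vec Carrier k → Vec Carrier k → Vec Carrier k
  _∙ᵏ_ = zipWith _∙_

  εᵏ : ∀ {k} → Vec Carrier k
  εᵏ = replicate _ ε

  invᵏ : ∀ {k} → Vec Carrier k → Vec Carrier k
  invᵏ = map _⁻¹

  record Subgroup (k : ℕ) : Set where
    field
      mem      : Vec Carrier k → Bool
      has-ε    : T (mem εᵏ)
      closed-∙ : ∀ u v → T (mem u) → T (mem v) → T (mem (u ∙ᵏ v))
      closed-⁻¹ : ∀ u → T (mem u) → T (mem (invᵏ u))

  _∈ₛ_ : ∀ {k} → Vec Carrier k → Subgroup k → Set
  β ∈ₛ Δ = T (Subgroup.mem Δ β)

  -- β ∈ Δγ  (right coset), i.e. β γ⁻¹ ∈ Δ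
  InCoset : ∀ {k} → Subgroup k → Vec Carrier k → Vec Carrier k → Set
  InCoset Δ γ β = (β ∙ᵏ invᵏ γ) ∈ₛ Δ

  record Constraint (m : ℕ) : Set where
    field
      arity : ℕ
      vars  : Vec (Fin m) arity
      Δ     : Subgroup arity
      γ     : Vec Carrier arity

  record Instance : Set where
    field
      nvars : ℕ
      ncons : ℕ
      cons  : Fin ncons → Constraint nvars

  Satisfiable : Instance → Set
  Satisfiable I =
    Σ (Fin (Instance.nvars I) → Carrier) λ φ →
      ∀ j → let C = Instance.cons I j in
            InCoset (Constraint.Δ C) (Constraint.γ C) (map φ (Constraint.vars C))

-- Coloured graphs (vertex colours, coloured undirected edges; an edge
-- colouring is a relation, so parallel edges of different colours allowed).

record ColouredGraph (VCol ECol : Set) : Set₁ where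
  field
    V      : Set
    colour : V → VCol
    Arc    : V → V → ECol → Set

  Edge : V → V → ECol → Set
  Edge v w c = Arc v w c ⊎ Arc w v c

record _≅_ {VCol ECol : Set} (G H : ColouredGraph VCol ECol) : Set where
  open ColouredGraph
  field
    bij       : V G ↔ V H
  open Inverse bij using (to)
  field
    colour-pres : ∀ v → colour H (to v) ≡ colour G v
    edge-pres   : ∀ v w c → (Edge G v w c → Edge H (to v) (to w) c)
                          × (Edge H (to v) (to w) c → Edge G v w c)

module _ (Γ : FiniteGroup) (I : Instance Γ) where
  open FiniteGroup Γ
  open Instance I
  open Constraint

  data VColour : Set where
    L-var : Fin nvars → VColour
    L-con : Fin ncons → VColour

  ECol : Set
  ECol = ℕ

  -- common construction, parametrised by the coset chosen per constraint:
  -- `inC j β` says that β is a vertex of the j-th constraint gadget.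
  private
    build : (∀ j → Vec Carrier (arity (cons j)) → Set) → ColouredGraph VColour ECol
    build inC = record
      { V      = Vtx
      ; colour = col
      ; Arc    = arc
      }
      where
      Vtx : Set
      Vtx = (Fin nvars × Carrier)
          ⊎ Σ (Fin ncons) (λ j → Σ (Vec Carrier (arity (cons j))) (inC j))
      col : Vtx → VColour
      col (inj₁ (x , _)) = L-var x
      col (inj₂ (j , _)) = L-con j
      arc : Vtx → Vtx → ECol → Set
      arc (inj₂ (j , β , _)) (inj₁ (x , a)) n =
        Σ (Fin (arity (cons j))) λ i →
          (toℕ i ≡ n) × (lookup (vars (cons j)) i ≡ x) × (lookup β i ≡ a)
      arc _ _ _ = ⊥

  G : ColouredGraph VColour ECol
  G = build (λ j → InCoset Γ (Δ (cons j)) (γ (cons j)))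

  G̃ : ColouredGraph VColour ECol
  G̃ = build (λ j β → _∈ₛ_ Γ β (Δ (cons j)))

-- A solution φ gives an isomorphism G(𝒞) ≅ G̃(𝒞) that translates every
-- gadget by φ: the variable vertex a⁽ˣ⁾ goes to (a φ(x)⁻¹)⁽ˣ⁾ and the constraint
-- vertex β goes to β φ(x̄)⁻¹, which lies in Δ because φ(x̄) lies in the same
-- coset Δγ as β. Conversely, given an isomorphism, read off φ(x) as the label
-- of the preimage of ε⁽ˣ⁾. The identity vertex of each gadget of G̃(𝒞) has the
-- neighbours ε⁽ˣⁱ⁾, so its preimage is a vertex β ∈ Δγ whose neighbours are the
-- preimages of the ε⁽ˣⁱ⁾; hence φ(x̄) = β ∈ Δγ.
module Submission where

open import Defs
open import Level using (0ℓ)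
open import Algebra.Bundles using (Group)
import Algebra.Properties.Group as GroupProperties
open import Data.Bool using (Bool; T)
open import Data.Bool.Properties using (T-irrelevant)
open import Data.Fin using (Fin; toℕ)
open import Data.Fin.Properties using (toℕ-injective)
open import Data.Nat using (ℕ)
open import Data.Product using (Σ; _×_; _,_; proj₁)
open import Data.Sum using (_⊎_; inj₁; inj₂)
import Data.Sum as Sum
open import Data.Vec using (Vec; lookup; map; tabulate)
open import Data.Vec.Properties
  using ( zipWith-assoc; zipWith-identityˡ; zipWith-identityʳ
        ; zipWith-inverseˡ; zipWith-inverseʳ
        ; lookup-zipWith; lookup-map; lookup-replicate
        ; tabulate∘lookup; tabulate-cong )
open import Function.Base using (_∘_)
open import Function.Bundles using (_⇔_; mk⇔; mk↔ₛ′; Inverse)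
open import Relation.Binary.PropositionalEquality

lookup-extensionality : ∀ {A : Set} {n} (u v : Vec A n) →
                        (∀ i → lookup u i ≡ lookup v i) → u ≡ v
lookup-extensionality u v eq = begin
  u                   ≡⟨ tabulate∘lookup u ⟨
  tabulate (lookup u) ≡⟨ tabulate-cong eq ⟩
  tabulate (lookup v) ≡⟨ tabulate∘lookup v ⟩
  v                   ∎
  where open ≡-Reasoning

module _ (Γ : FiniteGroup) where
  open FiniteGroup Γ renaming (_∙_ to infixl 7 _∙_; _⁻¹ to infix 8 _⁻¹)

  infixl 7 _·_ _/_
  _·_ : ∀ {k} → Vec Carrier k → Vec Carrier k → Vec Carrier k
  _·_ = _∙ᵏ_ Γ

  _/_ : ∀ {k} → Vec Carrier k → Vec Carrier k → Vec Carrier k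
  u / v = u · invᵏ Γ v

  group : Group 0ℓ 0ℓ
  group = record { isGroup = isGroup }

  powerGroup : ℕ → Group 0ℓ 0ℓ
  powerGroup k = record
    { _≈_     = _≡_
    ; _∙_     = _·_ {k}
    ; ε       = εᵏ Γ
    ; _⁻¹     = invᵏ Γ
    ; isGroup = record
      { isMonoid = record
        { isSemigroup = record
          { isMagma = record { isEquivalence = isEquivalence ; ∙-cong = cong₂ _ }
          ; assoc   = zipWith-assoc G.assoc
          }
        ; identity = zipWith-identityˡ G.identityˡ , zipWith-identityʳ G.identityʳ
        }
      ; inverse = zipWith-inverseˡ G.inverseˡ , zipWith-inverseʳ G.inverseʳ
      ; ⁻¹-cong = cong _
      }
    }
    where module G = Group group

  lookup-// : ∀ {k} (u v : Vec Carrier k) i →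
              lookup (u / v) i ≡ lookup u i ∙ lookup v i ⁻¹
  lookup-// u v i = trans (lookup-zipWith _∙_ i u _) (cong (_ ∙_) (lookup-map i _⁻¹ v))

  module _ {k} (Δ : Subgroup Γ k) {γ : Vec Carrier k} where
    open Subgroup Δ
    open Group (powerGroup k) using (assoc)
    open GroupProperties (powerGroup k) using (//-rightDividesˡ; ⁻¹-anti-homo-//)
    open ≡-Reasoning

    ∈Δγ⇒/∈Δ : ∀ {β α} → InCoset Γ Δ γ β → InCoset Γ Δ γ α → _∈ₛ_ Γ (β / α) Δ
    ∈Δγ⇒/∈Δ {β} {α} β∈ α∈ =
      subst (λ δ → _∈ₛ_ Γ δ Δ) β/γ·[α/γ]⁻¹≡β/α (closed-∙ _ _ β∈ (closed-⁻¹ _ α∈))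
      where
      β/γ·[α/γ]⁻¹≡β/α : β / γ · invᵏ Γ (α / γ) ≡ β / α
      β/γ·[α/γ]⁻¹≡β/α = begin
        β / γ · invᵏ Γ (α / γ) ≡⟨ cong (β / γ ·_) (⁻¹-anti-homo-// α γ) ⟩
        β / γ · (γ / α)        ≡⟨ assoc (β / γ) γ (invᵏ Γ α) ⟨
        β / γ · γ / α          ≡⟨ cong (_/ α) (//-rightDividesˡ γ β) ⟩
        β / α                  ∎

    ∈Δ⇒·∈Δγ : ∀ {δ α} → _∈ₛ_ Γ δ Δ → InCoset Γ Δ γ α → InCoset Γ Δ γ (δ · α)
    ∈Δ⇒·∈Δγ {δ} {α} δ∈ α∈ =
      subst (λ u → _∈ₛ_ Γ u Δ) (sym (assoc δ α (invᵏ Γ γ))) (closed-∙ _ _ δ∈ α∈)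

  module _ (𝒞 : Instance Γ) where
    open Instance 𝒞
    open Constraint
    open ColouredGraph using (V; Arc; Edge; colour)

    Solution : (Fin nvars → Carrier) → Set
    Solution φ = ∀ j → InCoset Γ (Δ (cons j)) (γ (cons j)) (map φ (vars (cons j)))

    Tuple : Fin ncons → Set
    Tuple j = Vec Carrier (arity (cons j))

    ∈Δ? ∈Δγ? : ∀ j → Tuple j → Bool
    ∈Δ?  j β = Subgroup.mem (Δ (cons j)) β
    ∈Δγ? j β = Subgroup.mem (Δ (cons j)) (β / γ (cons j))

    constraintVertex-≡ : ∀ {P : ∀ j → Tuple j → Bool} j {β β′}
                         {p : T (P j β)} {p′ : T (P j β′)} → β ≡ β′ →
                         _≡_ {A = (Fin nvars × Carrier)
                                ⊎ Σ (Fin ncons) λ j → Σ (Tuple j) λ β → T (P j β)}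
                             (inj₂ (j , β , p)) (inj₂ (j , β′ , p′))
    constraintVertex-≡ j {p = p} {p′} refl = cong (λ q → inj₂ (j , _ , q)) (T-irrelevant p p′)

    module _ {φ : Fin nvars → Carrier} (φ-solves : Solution φ) where
      open GroupProperties group using (∙-cancelʳ; //-rightDividesˡ; //-rightDividesʳ)
      module PowerGroup k = GroupProperties (powerGroup k)

      φ̄ : ∀ j → Tuple j
      φ̄ j = map φ (vars (cons j))

      lookup-/φ̄ : ∀ j β i → lookup (β / φ̄ j) i ≡ lookup β i ∙ φ (lookup (vars (cons j)) i) ⁻¹
      lookup-/φ̄ j β i = trans (lookup-// β (φ̄ j) i)
                              (cong (λ a → lookup β i ∙ a ⁻¹) (lookup-map i φ (vars (cons j))))

      translate : V (G Γ 𝒞) → V (G̃ Γ 𝒞)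
      translate (inj₁ (x , a))      = inj₁ (x , a ∙ φ x ⁻¹)
      translate (inj₂ (j , β , β∈)) = inj₂ (j , β / φ̄ j , ∈Δγ⇒/∈Δ (Δ (cons j)) β∈ (φ-solves j))

      untranslate : V (G̃ Γ 𝒞) → V (G Γ 𝒞)
      untranslate (inj₁ (x , a))      = inj₁ (x , a ∙ φ x)
      untranslate (inj₂ (j , δ , δ∈)) = inj₂ (j , δ · φ̄ j , ∈Δ⇒·∈Δγ (Δ (cons j)) δ∈ (φ-solves j))

      translate∘untranslate : ∀ v → translate (untranslate v) ≡ v
      translate∘untranslate (inj₁ (x , a))     = cong (λ b → inj₁ (x , b)) (//-rightDividesʳ (φ x) a)
      translate∘untranslate (inj₂ (j , δ , _)) = constraintVertex-≡ {∈Δ?} j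
                                                   (PowerGroup.//-rightDividesʳ _ (φ̄ j) δ)

      untranslate∘translate : ∀ v → untranslate (translate v) ≡ v
      untranslate∘translate (inj₁ (x , a))     = cong (λ b → inj₁ (x , b)) (//-rightDividesˡ (φ x) a)
      untranslate∘translate (inj₂ (j , β , _)) = constraintVertex-≡ {∈Δγ?} j
                                                   (PowerGroup.//-rightDividesˡ _ (φ̄ j) β)

      translate-arc : ∀ v w n → Arc (G Γ 𝒞) v w n → Arc (G̃ Γ 𝒞) (translate v) (translate w) n
      translate-arc (inj₂ (j , β , _)) (inj₁ _) n (i , i≡n , refl , refl) =
        i , i≡n , refl , lookup-/φ̄ j β i

      untranslate-arc : ∀ v w n → Arc (G̃ Γ 𝒞) (translate v) (translate w) n → Arc (G Γ 𝒞) v w n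
      untranslate-arc (inj₂ (j , β , _)) (inj₁ (x , a)) n (i , i≡n , refl , e) =
        i , i≡n , refl , ∙-cancelʳ (φ x ⁻¹) _ _ (trans (sym (lookup-/φ̄ j β i)) e)

      translation-≅ : G Γ 𝒞 ≅ G̃ Γ 𝒞
      translation-≅ = record
        { bij         = mk↔ₛ′ translate untranslate translate∘untranslate untranslate∘translate
        ; colour-pres = λ { (inj₁ _) → refl ; (inj₂ _) → refl }
        ; edge-pres   = λ v w n → Sum.map (translate-arc v w n) (translate-arc w v n)
                                , Sum.map (untranslate-arc v w n) (untranslate-arc w v n)
        }

    identityVertex : Fin ncons → V (G̃ Γ 𝒞)
    identityVertex j = inj₂ (j , εᵏ Γ , Subgroup.has-ε (Δ (cons j)))

    identityVertex-neighbour : ∀ j i t → Edge (G̃ Γ 𝒞) (identityVertex j) t (toℕ i) →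
                               t ≡ inj₁ (lookup (vars (cons j)) i , ε)
    identityVertex-neighbour j i (inj₁ _) (inj₁ (i′ , i′≡i , refl , refl))
      with toℕ-injective i′≡i
    ... | refl = cong (λ a → inj₁ (_ , a)) (lookup-replicate i ε)
    identityVertex-neighbour j i (inj₂ _) (inj₂ ())

    module _ (iso : G Γ 𝒞 ≅ G̃ Γ 𝒞) where
      open _≅_ iso
      open Inverse bij using (to; from; strictlyInverseˡ; strictlyInverseʳ)

      -- The value ε on constraint vertices is junk that the proof never reads.
      label : V (G Γ 𝒞) → Carrier
      label (inj₁ (_ , a)) = a
      label (inj₂ _)       = ε

      assignment : Fin nvars → Carrier
      assignment x = label (from (inj₁ (x , ε)))

      colour-preimage : ∀ {v} w → to w ≡ v → colour (G̃ Γ 𝒞) v ≡ colour (G Γ 𝒞) w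
      colour-preimage w refl = colour-pres w

      preimage-solves : ∀ j w → to w ≡ identityVertex j →
                        InCoset Γ (Δ (cons j)) (γ (cons j)) (map assignment (vars (cons j)))
      preimage-solves j (inj₁ w) to-w≡ with colour-preimage (inj₁ w) to-w≡
      ... | ()
      preimage-solves j (inj₂ (j′ , β , β∈)) to-w≡
        with colour-preimage (inj₂ (j′ , β , β∈)) to-w≡
      ... | refl = subst (InCoset Γ (Δ (cons j)) (γ (cons j))) (sym assignment≡β) β∈
        where
        xs = vars (cons j)
        w  = inj₂ (j , β , β∈)

        to-neighbour : ∀ i → to (inj₁ (lookup xs i , lookup β i)) ≡ inj₁ (lookup xs i , ε)
        to-neighbour i = identityVertex-neighbour j i (to v)
          (subst (λ u → Edge (G̃ Γ 𝒞) u (to v) (toℕ i)) to-w≡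
                 (proj₁ (edge-pres w v (toℕ i)) (inj₁ (i , refl , refl , refl))))
          where v = inj₁ (lookup xs i , lookup β i)

        assignment≡β : map assignment xs ≡ β
        assignment≡β = lookup-extensionality _ _ λ i → begin
          lookup (map assignment xs) i                        ≡⟨ lookup-map i assignment xs ⟩
          label (from (inj₁ (lookup xs i , ε)))               ≡⟨ cong (label ∘ from) (to-neighbour i) ⟨
          label (from (to (inj₁ (lookup xs i , lookup β i)))) ≡⟨ cong label (strictlyInverseʳ _) ⟩
          lookup β i                                          ∎
          where open ≡-Reasoning

      assignment-solves : Solution assignment
      assignment-solves j = preimage-solves j (from (identityVertex j)) (strictlyInverseˡ _)

lemma7 : (Γ : FiniteGroup) (𝒞 : Instance Γ) →
         Satisfiable Γ 𝒞 ⇔ (G Γ 𝒞 ≅ G̃ Γ 𝒞)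
lemma7 Γ 𝒞 = mk⇔ (λ (_ , φ-solves) → translation-≅ Γ 𝒞 φ-solves)
               (λ iso → assignment Γ 𝒞 iso , assignment-solves Γ 𝒞 iso)
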